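{- If every node $P$ of the generating tree $\mathcal T_o$ is replaced by the pair $(i,j)$, where $i$ is the left outer degree of $P$ and $j$ the degree of its sink, one obtains exactly the labelled plane tree $\mathcal T$. In particular $\mathcal T_o$ is isomorphic to $\mathcal T$.
   Context: A plane bipolar orientation is an acyclic orientation of a planar map (connected graph embedded in the plane, up to continuous deformation) with a unique source $s$ and unique sink $t$, both on the outer face. The left border is the oriented $s$–$t$ path along the outer face having the outer face on its left; its length is the left outer degree. For a plane bipolar orientation $P$ with left outer degree $i$ and sink degree $j$, let $v_1=s,v_2,\dots,v_i,v_{i+1}=t$ be the vertices of the left border, and $e_1,\dots,e_j$ the edges incident to $t$ from right to left (outer face to the right of $e_1$ and to the left of $e_j$). For $1\le k\le i$, $L_k(P)$ is obtained by adding an edge from $v_k$ to $t$ having the outer face on its left. For $1\le k\le j$, $R_k(P)$ is obtained by splitting $t$ into two vertices $t$ and $v$, keeping $e_1,\dots,e_{k-1}$ attached to $t$ and attaching $e_k,\dots,e_j$ to $v$, and adding an edge from $v$ to $t$. $\mathcal T_o$ is the rooted plane tree whose root is the one-edge orientation and in which the children of $P$ are, from left to right, $L_1(P),\dots,L_i(P),R_j(P),\dots,R_1(P)$ (its level $n$ consists of all plane bipolar orientations with $n$ edges, each once). $\mathcal T$ is the rooted plane labelled tree with root label $(1,1)$ in which a node labelled $(i,j)$ has children labelled, from left to right, $(1,j+1),\dots,(i,j+1),(i+1,j),\dots,(i+1,1)$. -}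

module Defs where

open import Data.Nat using (ℕ; zero; suc; _∸_; _≡ᵇ_)
open import Data.Bool using (Bool; true; false; if_then_else_)
open import Data.List using (List; []; _∷_; _++_; length; map; take; drop; reverse; upTo; last)
open import Data.Bool.ListAction using (any)
open import Data.Maybe using (Maybe; just; nothing; _>>=_)
open import Data.Product using (_×_; _,_)

-- Combinatorial-map encoding of plane (bipolar) orientations.
--
-- Vertices and edges are natural numbers (vertices < nV, edges < nE).  Each edge has two darts:
-- out e (its end at the tail) and inn e (its end at the head).
-- rot v lists the darts at v in CLOCKWISE cyclic order; this rotation
-- system is the embedding (a map up to continuous deformation).
-- Convention fixing the outer face: the list rot snk starts right after
-- the outer-face corner at the sink, i.e. the outer face is the face
-- containing the corner of snk between the last and first dart of rot snk.
-- (So rot snk = inn e₁ ∷ … ∷ inn eⱼ with e₁ … eⱼ from right to left.)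

data Dart : Set where
  out : ℕ → Dart
  inn : ℕ → Dart

_≡ᴰ_ : Dart → Dart → Bool
out a ≡ᴰ out b = a ≡ᵇ b
inn a ≡ᴰ inn b = a ≡ᵇ b
_ ≡ᴰ _ = false

elemᴰ : Dart → List Dart → Bool
elemᴰ d = any (d ≡ᴰ_)

record PMap : Set where
  constructor mkPMap
  field
    nV nE src snk : ℕ
    tl hd : ℕ → ℕ
    rot : ℕ → List Dart

open PMap public

-- clockwise predecessor (= counterclockwise successor) of d in a cyclic list
predIn : Dart → List Dart → Maybe Dart
predIn d [] = nothing
predIn d (x ∷ xs) = if x ≡ᴰ d then last (x ∷ xs) else scan x xs
  where
  scan : Dart → List Dart → Maybe Dart
  scan prev [] = nothing
  scan prev (y ∷ ys) = if y ≡ᴰ d then just prev else scan y ys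

-- Walking the outer face backwards from the sink along the left border
-- (outer face on the right of the backward walk): having arrived at
-- w = tl e through the border edge e, the previous border edge is the one
-- whose dart follows out e counterclockwise around w.
lbWalk : PMap → ℕ → ℕ → List ℕ
lbWalk P zero e = e ∷ []
lbWalk P (suc f) e with tl P e ≡ᵇ src P
... | true = e ∷ []
... | false with predIn (out e) (rot P (tl P e))
...   | just (inn e') = lbWalk P f e' ++ e ∷ []
...   | _ = e ∷ []

-- edges of the left border, in order from s to t
leftBorder : PMap → List ℕ
leftBorder P with last (rot P (snk P))
... | just (inn e) = lbWalk P (nE P) e
... | _ = []

leftOuterDegree : PMap → ℕ
leftOuterDegree P = length (leftBorder P)

sinkDegree : PMap → ℕ
sinkDegree P = length (rot P (snk P))

label : PMap → ℕ × ℕ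
label P = leftOuterDegree P , sinkDegree P

oneEdge : PMap
oneEdge = mkPMap 2 1 0 1 (λ _ → 0) (λ _ → 1)
  (λ v → if v ≡ᵇ 0 then out 0 ∷ [] else if v ≡ᵇ 1 then inn 0 ∷ [] else [])

at : List ℕ → ℕ → Maybe ℕ
at [] _ = nothing
at (x ∷ xs) zero = just x
at (x ∷ xs) (suc n) = at xs n

insertBefore : Dart → Dart → List Dart → List Dart
insertBefore d new [] = []
insertBefore d new (x ∷ xs) =
  if x ≡ᴰ d then new ∷ x ∷ xs else x ∷ insertBefore d new xs

-- L_k (1 ≤ k ≤ i): new edge (index nE) from v_k to t, outer face on its
-- left: it becomes the leftmost edge at t, and at v_k it is inserted in
-- the outer corner, i.e. just before the border edge v_k → v_{k+1}.
opL : ℕ → PMap → PMap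
opL k P with at (leftBorder P) (k ∸ 1)
... | nothing = P
... | just ek = mkPMap (nV P) (suc (nE P)) (src P) (snk P) tl' hd' rot'
  where
  tl' : ℕ → ℕ
  tl' e = if e ≡ᵇ nE P then tl P ek else tl P e
  hd' : ℕ → ℕ
  hd' e = if e ≡ᵇ nE P then snk P else hd P e
  rot' : ℕ → List Dart
  rot' v = if v ≡ᵇ snk P then rot P (snk P) ++ inn (nE P) ∷ []
           else if v ≡ᵇ tl P ek then insertBefore (out ek) (out (nE P)) (rot P v)
           else rot P v

-- R_k (1 ≤ k ≤ j): split t into t (keeping e_1..e_{k-1}) and a new vertex
-- v = nV (receiving e_k..e_j), and add the edge v → t (index nE).
opR : ℕ → PMap → PMap
opR k P = mkPMap (suc (nV P)) (suc (nE P)) (src P) (snk P) tl' hd' rot'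
  where
  kept moved : List Dart
  kept = take (k ∸ 1) (rot P (snk P))
  moved = drop (k ∸ 1) (rot P (snk P))
  tl' : ℕ → ℕ
  tl' e = if e ≡ᵇ nE P then nV P else tl P e
  hd' : ℕ → ℕ
  hd' e = if e ≡ᵇ nE P then snk P else if elemᴰ (inn e) moved then nV P else hd P e
  rot' : ℕ → List Dart
  rot' v = if v ≡ᵇ snk P then kept ++ inn (nE P) ∷ []
           else if v ≡ᵇ nV P then out (nE P) ∷ moved
           else rot P v

range1 : ℕ → List ℕ
range1 n = map suc (upTo n)

childrenₒ : PMap → List PMap
childrenₒ P = map (λ k → opL k P) (range1 (leftOuterDegree P))
           ++ map (λ k → opR k P) (reverse (range1 (sinkDegree P)))

childrenT : ℕ × ℕ → List (ℕ × ℕ)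
childrenT (i , j) = map (λ k → (k , suc j)) (range1 i)
                 ++ map (λ k → (suc i , k)) (reverse (range1 j))

-- plane rooted trees given by a root and a children function; nodes are
-- addressed by paths of (0-based, left-to-right) child positions
nthM : {A : Set} → List A → ℕ → Maybe A
nthM [] _ = nothing
nthM (x ∷ xs) zero = just x
nthM (x ∷ xs) (suc n) = nthM xs n

nodeAt : {A : Set} → (A → List A) → A → List ℕ → Maybe A
nodeAt ch a [] = just a
nodeAt ch a (n ∷ p) = nthM (ch a) n >>= λ b → nodeAt ch b p

module Submission where

-- The theorem is an instance of a general relabelling principle for plane trees
-- given by a root and a children function: if a relation R between the nodes of
-- two such trees relates the roots, forces f a ≡ b whenever R a b, and relates
-- the children lists position by position, then f sends the node at every
-- address of the first tree to the node at the same address of the second.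
--
-- We take for R the invariant "Labelled P i j": the left border of P is given
-- explicitly as a border chain (a walk from s along the outer face, with
-- increasing vertex numbers), its last edge is the leftmost edge at the sink,
-- and the sink has j darts.  The invariant lets us evaluate leftBorder, hence
-- label P ≡ (i , j).  It holds for the one-edge orientation, and L_k resp. R_k
-- turn it into the invariant for (k , j+1) resp. (i+1 , k): L_k cuts the chain
-- after its k-th edge and appends the new edge, R_k appends the new edge v → t
-- after the whole chain.  This is exactly the shape of the children in 𝒯.

open import Defs
open import Data.Nat using (ℕ; zero; suc; _∸_; _≡ᵇ_; _<_; _≤_; z≤n; s≤s)
open import Data.Nat.Properties
  using (≤-trans; ≤-refl; <⇒≤; <⇒≢; n<1+n; n≤1+n; m≤n⇒m≤1+n; m<n⇒m<1+n;
         ≤-<-trans; m≤n⇒m⊓n≡m; m≤n⇒m<n∨m≡n; ≤-pred; +-comm)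
open import Data.Bool using (true; false; if_then_else_)
open import Data.List using (List; []; _∷_; _++_; length; map; take; drop; reverse; last)
open import Data.List.Properties using (length-take; length-++)
open import Data.List.Membership.Propositional using (_∈_)
open import Data.List.Membership.Propositional.Properties using (∈-map⁻; ∈-upTo⁻)
open import Data.List.Relation.Unary.Any using (here; there)
import Data.List.Relation.Unary.Any.Properties as Any
open import Data.List.Relation.Binary.Pointwise using (Pointwise; []; _∷_; ++⁺)
open import Data.Maybe using (just; _>>=_)
open import Data.Product using (_×_; _,_; ∃)
open import Data.Empty using (⊥-elim)
open import Data.Sum using (inj₁; inj₂)
open import Function using (_∘_)
open import Relation.Binary.PropositionalEquality
import Data.Maybe

-- The operations in Defs branch on the Boolean equality _≡ᵇ_; these two facts
-- evaluate such branches.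

≡ᵇ-refl : ∀ n → (n ≡ᵇ n) ≡ true
≡ᵇ-refl zero = refl
≡ᵇ-refl (suc n) = ≡ᵇ-refl n

≢⇒≡ᵇ-false : ∀ {m n} → m ≢ n → (m ≡ᵇ n) ≡ false
≢⇒≡ᵇ-false {zero} {zero} m≢n = ⊥-elim (m≢n refl)
≢⇒≡ᵇ-false {zero} {suc n} m≢n = refl
≢⇒≡ᵇ-false {suc m} {zero} m≢n = refl
≢⇒≡ᵇ-false {suc m} {suc n} m≢n = ≢⇒≡ᵇ-false (m≢n ∘ cong suc)

last-∷ʳ : ∀ {A : Set} (xs : List A) y → last (xs ++ y ∷ []) ≡ just y
last-∷ʳ [] y = refl
last-∷ʳ (x ∷ []) y = refl
last-∷ʳ (x ∷ x' ∷ xs) y = last-∷ʳ (x' ∷ xs) y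

length-∷ʳ : ∀ {A : Set} (xs : List A) y → length (xs ++ y ∷ []) ≡ suc (length xs)
length-∷ʳ xs y = trans (length-++ xs) (+-comm (length xs) 1)

at-∷ʳ : ∀ (xs : List ℕ) y → at (xs ++ y ∷ []) (length xs) ≡ just y
at-∷ʳ [] y = refl
at-∷ʳ (x ∷ xs) y = at-∷ʳ xs y

at-++ˡ : ∀ (xs ys : List ℕ) n → n < length xs → at (xs ++ ys) n ≡ at xs n
at-++ˡ (x ∷ xs) ys zero _ = refl
at-++ˡ (x ∷ xs) ys (suc n) (s≤s n<) = at-++ˡ xs ys n n<

last-drop : ∀ {A : Set} (y : A) m xs → m < length xs → last (y ∷ drop m xs) ≡ last xs
last-drop y zero (x ∷ xs) _ = refl
last-drop y (suc m) (x ∷ []) (s≤s ())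
last-drop y (suc m) (x ∷ x' ∷ xs) (s≤s m<) = last-drop y m (x' ∷ xs) m<

insertBefore-head : ∀ x d rest → insertBefore (out x) d (out x ∷ rest) ≡ d ∷ out x ∷ rest
insertBefore-head x d rest rewrite ≡ᵇ-refl x = refl

range1-member : ∀ {k n} → k ∈ range1 n → ∃ λ m → m < n × k ≡ suc m
range1-member k∈ with ∈-map⁻ suc k∈
... | m , m∈ , refl = m , ∈-upTo⁻ m∈ , refl

pointwise-map : ∀ {A B C : Set} {R : A → B → Set} (f : C → A) (g : C → B) xs →
  (∀ {k} → k ∈ xs → R (f k) (g k)) → Pointwise R (map f xs) (map g xs)
pointwise-map f g [] related = []
pointwise-map f g (x ∷ xs) related = related (here refl) ∷ pointwise-map f g xs (related ∘ there)

module Relabelling {A B : Set} (chA : A → List A) (chB : B → List B) (f : A → B)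
  (R : A → B → Set)
  (R⇒f : ∀ {a b} → R a b → f a ≡ b)
  (R-children : ∀ {a b} → R a b → Pointwise R (chA a) (chB b)) where

  mutual
    relabel : ∀ {a b} → R a b → ∀ p →
      Data.Maybe.map f (nodeAt chA a p) ≡ nodeAt chB b p
    relabel r [] = cong just (R⇒f r)
    relabel r (n ∷ p) = relabel-child (R-children r) n p

    relabel-child : ∀ {as bs} → Pointwise R as bs → ∀ n p →
      Data.Maybe.map f (nthM as n >>= λ a → nodeAt chA a p) ≡ (nthM bs n >>= λ b → nodeAt chB b p)
    relabel-child [] n p = refl
    relabel-child (r ∷ _) zero p = relabel r p
    relabel-child (_ ∷ rs) (suc n) p = relabel-child rs n p

-- BorderChain P es e: the edges es ++ [e] form an initial segment of the left
-- border starting at s.  Each non-first edge e leaves a vertex other than s and t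
-- whose clockwise rotation starts with e and ends with the incoming previous
-- edge e' (so lbWalk steps from e to e'); tails strictly increase along the chain.
data BorderChain (P : PMap) : List ℕ → ℕ → Set where
  first : ∀ {e} → tl P e ≡ src P → e < nE P → BorderChain P [] e
  next  : ∀ {es e' e} → BorderChain P es e' → tl P e' < tl P e
        → tl P e ≢ src P → tl P e ≢ snk P
        → (rest : List Dart) → rot P (tl P e) ≡ out e ∷ rest
        → last (out e ∷ rest) ≡ just (inn e')
        → e < nE P → BorderChain P (es ++ e' ∷ []) e

chain-edge< : ∀ {P es e} → BorderChain P es e → e < nE P
chain-edge< (first _ e<) = e<
chain-edge< (next _ _ _ _ _ _ _ e<) = e<

lbWalk-chain : ∀ P {es e} f → BorderChain P es e → length es ≤ f → lbWalk P f e ≡ es ++ e ∷ []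
lbWalk-chain P zero (first _ _) _ = refl
lbWalk-chain P (suc f) (first tl≡src _) _ rewrite tl≡src | ≡ᵇ-refl (src P) = refl
lbWalk-chain P zero (next {es} {e'} _ _ _ _ _ _ _ _) len≤0
  with () ← subst (_≤ 0) (length-∷ʳ es e') len≤0
lbWalk-chain P (suc f) (next {es} {e'} {e} c _ ≢src _ _ rot≡ last≡ _) len≤
  rewrite ≢⇒≡ᵇ-false ≢src | rot≡ | ≡ᵇ-refl e | last≡
        | lbWalk-chain P f c (≤-pred (subst (_≤ suc f) (length-∷ʳ es e') len≤)) = refl

chain-transfer : ∀ {P P' es e} b → src P' ≡ src P → snk P' ≡ snk P → nE P ≤ nE P'
  → (∀ x → x < nE P → tl P' x ≡ tl P x)
  → (∀ v → v ≤ b → v ≢ snk P → rot P' v ≡ rot P v)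
  → BorderChain P es e → tl P e ≤ b → BorderChain P' es e
chain-transfer b src≡ snk≡ nE≤ tl≡ rot≡ (first {e} tl≡src e<) _ =
  first (trans (tl≡ e e<) (trans tl≡src (sym src≡))) (≤-trans e< nE≤)
chain-transfer {P} {P'} b src≡ snk≡ nE≤ tl≡ rot≡ (next {es} {e'} {e} c tl< ≢src ≢snk rest rot≡' last≡ e<) tl≤b =
  next (chain-transfer b src≡ snk≡ nE≤ tl≡ rot≡ c (≤-trans (<⇒≤ tl<) tl≤b))
       (subst₂ _<_ (sym (tl≡ e' (chain-edge< c))) (sym (tl≡ e e<)) tl<)
       (λ eq → ≢src (trans (sym (tl≡ e e<)) (trans eq src≡)))
       (λ eq → ≢snk (trans (sym (tl≡ e e<)) (trans eq snk≡)))
       rest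
       (trans (cong (rot P') (tl≡ e e<)) (trans (rot≡ (tl P e) tl≤b ≢snk) rot≡'))
       last≡ (≤-trans e< nE≤)

chain-prefix : ∀ {P es e} → BorderChain P es e → ∀ idx → idx ≤ length es →
  ∃ λ x → ∃ λ es' → at (es ++ e ∷ []) idx ≡ just x × BorderChain P es' x
                    × length es' ≡ idx × tl P x ≤ tl P e
chain-prefix {e = e} (first tl≡src e<) zero z≤n = e , [] , refl , first tl≡src e< , refl , ≤-refl
chain-prefix c@(next {es} {e'} {e} c' tl< _ _ _ _ _ _) idx idx≤ with m≤n⇒m<n∨m≡n idx≤
... | inj₂ refl = e , es ++ e' ∷ [] , at-∷ʳ (es ++ e' ∷ []) e , c , refl , ≤-refl
... | inj₁ idx<
  with x , es' , at≡ , cx , len≡ , tl≤ ← chain-prefix c' idx (≤-pred (subst (idx <_) (length-∷ʳ es e') idx<))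
  = x , es' , trans (at-++ˡ (es ++ e' ∷ []) (e ∷ []) idx idx<) at≡ , cx , len≡ , ≤-trans tl≤ (<⇒≤ tl<)

-- The invariant: P has left outer degree i and sink degree j, witnessed by an
-- explicit left border whose last edge is the leftmost edge at the sink; the
-- vertex bounds make nV P a fresh vertex above all border vertices.
record Labelled (P : PMap) (i j : ℕ) : Set where
  field
    border     : List ℕ
    top        : ℕ
    chain      : BorderChain P border top
    left-deg   : suc (length border) ≡ i
    border≤nE  : length border ≤ nE P
    sink-left  : last (rot P (snk P)) ≡ just (inn top)
    sink-deg   : length (rot P (snk P)) ≡ j
    src<nV     : src P < nV P
    snk<nV     : snk P < nV P
    top<nV     : tl P top < nV P

open Labelled

leftBorder-eq : ∀ {P i j} (inv : Labelled P i j) → leftBorder P ≡ border inv ++ top inv ∷ []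
leftBorder-eq {P} inv rewrite sink-left inv = lbWalk-chain P (nE P) (chain inv) (border≤nE inv)

leftOuterDegree-eq : ∀ {P i j} → Labelled P i j → leftOuterDegree P ≡ i
leftOuterDegree-eq inv = trans (cong length (leftBorder-eq inv))
                               (trans (length-∷ʳ (border inv) (top inv)) (left-deg inv))

label-eq : ∀ {P i j} → Labelled P i j → label P ≡ (i , j)
label-eq inv = cong₂ _,_ (leftOuterDegree-eq inv) (sink-deg inv)

-- The root of 𝒯ₒ has label (1 , 1): its only edge is the whole left border.
oneEdge-labelled : Labelled oneEdge 1 1
oneEdge-labelled = record
  { border = [] ; top = 0 ; chain = first refl (s≤s z≤n) ; left-deg = refl ; border≤nE = z≤n
  ; sink-left = refl ; sink-deg = refl
  ; src<nV = s≤s z≤n ; snk<nV = s≤s (s≤s z≤n) ; top<nV = s≤s z≤n }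

-- The map obtained from P by adding the edge nE P from the tail of x to t as the
-- new leftmost edge at t, inserted before x at its tail.  It is L_k P when x is
-- the k-th left-border edge.
leftEdge : ℕ → PMap → PMap
leftEdge x P = mkPMap (nV P) (suc (nE P)) (src P) (snk P)
  (λ e → if e ≡ᵇ nE P then tl P x else tl P e)
  (λ e → if e ≡ᵇ nE P then snk P else hd P e)
  (λ v → if v ≡ᵇ snk P then rot P (snk P) ++ inn (nE P) ∷ []
         else if v ≡ᵇ tl P x then insertBefore (out x) (out (nE P)) (rot P v)
         else rot P v)

opL-leftEdge : ∀ {P k x} → at (leftBorder P) (k ∸ 1) ≡ just x → opL k P ≡ leftEdge x P
opL-leftEdge {P} {k} at≡ with at (leftBorder P) (k ∸ 1) | at≡
... | just _ | refl = refl

leftEdge-labelled : ∀ {P i j es x} → Labelled P i j → BorderChain P es x →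
  length es ≤ nE P → tl P x < nV P → Labelled (leftEdge x P) (suc (length es)) (suc j)
leftEdge-labelled {P = P} {es = es} {x = x} inv c es≤ x<nV = record
  { border = es ; top = nE P ; chain = new-chain c ; left-deg = refl
  ; border≤nE = m≤n⇒m≤1+n es≤
  ; sink-left = trans (cong last rot-snk) (last-∷ʳ (rot P (snk P)) (inn (nE P)))
  ; sink-deg = trans (cong length rot-snk)
                     (trans (length-∷ʳ (rot P (snk P)) (inn (nE P))) (cong suc (sink-deg inv)))
  ; src<nV = src<nV inv ; snk<nV = snk<nV inv
  ; top<nV = subst (_< nV P) (sym tl-new) x<nV }
  where
  Q : PMap
  Q = leftEdge x P

  tl-new : tl Q (nE P) ≡ tl P x
  tl-new rewrite ≡ᵇ-refl (nE P) = refl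

  tl-old : ∀ y → y < nE P → tl Q y ≡ tl P y
  tl-old y y< rewrite ≢⇒≡ᵇ-false (<⇒≢ y<) = refl

  rot-snk : rot Q (snk Q) ≡ rot P (snk P) ++ inn (nE P) ∷ []
  rot-snk rewrite ≡ᵇ-refl (snk P) = refl

  rot-tail : tl P x ≢ snk P → rot Q (tl P x) ≡ insertBefore (out x) (out (nE P)) (rot P (tl P x))
  rot-tail ≢snk rewrite ≢⇒≡ᵇ-false ≢snk | ≡ᵇ-refl (tl P x) = refl

  rot-other : ∀ v → v ≢ snk P → v ≢ tl P x → rot Q v ≡ rot P v
  rot-other v ≢snk ≢tl rewrite ≢⇒≡ᵇ-false ≢snk | ≢⇒≡ᵇ-false ≢tl = refl

  new-chain : ∀ {es'} → BorderChain P es' x → BorderChain Q es' (nE P)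
  new-chain (first tl≡src _) = first (trans tl-new tl≡src) (n<1+n _)
  new-chain (next {e' = e'} c' tl< ≢src ≢snk rest rot≡ last≡ _) =
    next (chain-transfer (tl P e') refl refl (n≤1+n _) tl-old
            (λ v v≤ ≢snk' → rot-other v ≢snk' (<⇒≢ (≤-<-trans v≤ tl<))) c' ≤-refl)
         (subst₂ _<_ (sym (tl-old e' (chain-edge< c'))) (sym tl-new) tl<)
         (λ eq → ≢src (trans (sym tl-new) eq))
         (λ eq → ≢snk (trans (sym tl-new) eq))
         (out x ∷ rest)
         (begin
            rot Q (tl Q (nE P))                                  ≡⟨ cong (rot Q) tl-new ⟩
            rot Q (tl P x)                                       ≡⟨ rot-tail ≢snk ⟩
            insertBefore (out x) (out (nE P)) (rot P (tl P x))   ≡⟨ cong (insertBefore (out x) (out (nE P))) rot≡ ⟩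
            insertBefore (out x) (out (nE P)) (out x ∷ rest)     ≡⟨ insertBefore-head x (out (nE P)) rest ⟩
            out (nE P) ∷ out x ∷ rest                            ∎)
         last≡ (n<1+n _)
    where open ≡-Reasoning

opL-labelled : ∀ {P i j m} → Labelled P i j → m < i → Labelled (opL (suc m) P) (suc m) (suc j)
opL-labelled {P} {j = j} {m} inv m<i
  with chain-prefix (chain inv) m (≤-pred (subst (m <_) (sym (left-deg inv)) m<i))
... | x , es , at≡ , c , refl , tl≤ =
  subst (λ Q → Labelled Q (suc (length es)) (suc j)) (sym (opL-leftEdge {k = suc (length es)} at-border))
        (leftEdge-labelled inv c es≤ (≤-<-trans tl≤ (top<nV inv)))
  where
  at-border : at (leftBorder P) (length es) ≡ just x
  at-border = trans (cong (λ l → at l (length es)) (leftBorder-eq inv)) at≡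
  es≤ : length es ≤ nE P
  es≤ = ≤-trans (≤-pred (subst (length es <_) (sym (left-deg inv)) m<i)) (border≤nE inv)

-- R_{m+1} on a labelled P: the new vertex v = nV P gets the edges e_{m+1} … e_j,
-- the last of which is the old top border edge; the new edge v → t extends the
-- whole left border, so the label becomes (i+1 , m+1).
opR-labelled : ∀ {P i j m} → Labelled P i j → m < j → Labelled (opR (suc m) P) (suc i) (suc m)
opR-labelled {P} {m = m} inv m<j = record
  { border = border inv ++ top inv ∷ []
  ; top = nE P
  ; chain = extended-chain
  ; left-deg = cong suc (trans (length-∷ʳ (border inv) (top inv)) (left-deg inv))
  ; border≤nE = subst (_≤ suc (nE P)) (sym (length-∷ʳ (border inv) (top inv))) (s≤s (border≤nE inv))
  ; sink-left = trans (cong last rot-snk) (last-∷ʳ kept (inn (nE P)))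
  ; sink-deg = trans (cong length rot-snk)
                     (trans (length-∷ʳ kept (inn (nE P))) (cong suc kept-length))
  ; src<nV = m<n⇒m<1+n (src<nV inv)
  ; snk<nV = m<n⇒m<1+n (snk<nV inv)
  ; top<nV = subst (_< suc (nV P)) (sym tl-new) (n<1+n _)
  }
  where
  Q : PMap
  Q = opR (suc m) P

  kept moved : List Dart
  kept = take m (rot P (snk P))
  moved = drop m (rot P (snk P))

  m<deg : m < length (rot P (snk P))
  m<deg = subst (m <_) (sym (sink-deg inv)) m<j

  kept-length : length kept ≡ m
  kept-length = trans (length-take m (rot P (snk P))) (m≤n⇒m⊓n≡m (<⇒≤ m<deg))

  tl-new : tl Q (nE P) ≡ nV P
  tl-new rewrite ≡ᵇ-refl (nE P) = refl

  tl-old : ∀ y → y < nE P → tl Q y ≡ tl P y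
  tl-old y y< rewrite ≢⇒≡ᵇ-false (<⇒≢ y<) = refl

  -- rotations change only at t and at the new vertex, both off the old chain
  rot-old : ∀ v → v ≤ tl P (top inv) → v ≢ snk P → rot Q v ≡ rot P v
  rot-old v v≤ ≢snk rewrite ≢⇒≡ᵇ-false ≢snk | ≢⇒≡ᵇ-false (<⇒≢ (≤-<-trans v≤ (top<nV inv))) = refl

  rot-new : rot Q (nV P) ≡ out (nE P) ∷ moved
  rot-new rewrite ≢⇒≡ᵇ-false (λ eq → <⇒≢ (snk<nV inv) (sym eq)) | ≡ᵇ-refl (nV P) = refl

  rot-snk : rot Q (snk Q) ≡ kept ++ inn (nE P) ∷ []
  rot-snk rewrite ≡ᵇ-refl (snk P) = refl

  -- the old border, unchanged below v, followed by the new edge v → t: at v the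
  -- rotation is the new edge followed by e_{m+1} … e_j, ending with the top edge
  extended-chain : BorderChain Q (border inv ++ top inv ∷ []) (nE P)
  extended-chain =
    next (chain-transfer (tl P (top inv)) refl refl (n≤1+n _) tl-old rot-old (chain inv) ≤-refl)
         (subst₂ _<_ (sym (tl-old (top inv) (chain-edge< (chain inv)))) (sym tl-new) (top<nV inv))
         (λ eq → <⇒≢ (src<nV inv) (sym (trans (sym tl-new) eq)))
         (λ eq → <⇒≢ (snk<nV inv) (sym (trans (sym tl-new) eq)))
         moved
         (trans (cong (rot Q) tl-new) rot-new)
         (trans (last-drop (out (nE P)) m (rot P (snk P)) m<deg) (sink-left inv))
         (n<1+n _)

HasLabel : PMap → ℕ × ℕ → Set
HasLabel P (i , j) = Labelled P i j

children-labelled : ∀ {P i j} → Labelled P i j → Pointwise HasLabel (childrenₒ P) (childrenT (i , j))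
children-labelled {P} {i} {j} inv rewrite leftOuterDegree-eq inv | sink-deg inv =
  ++⁺ (pointwise-map (λ k → opL k P) (λ k → (k , suc j)) (range1 i) left)
      (pointwise-map (λ k → opR k P) (λ k → (suc i , k)) (reverse (range1 j)) (right ∘ Any.reverse⁻))
  where
  left : ∀ {k} → k ∈ range1 i → Labelled (opL k P) k (suc j)
  left k∈ with range1-member k∈
  ... | m , m<i , refl = opL-labelled inv m<i

  right : ∀ {k} → k ∈ range1 j → Labelled (opR k P) (suc i) k
  right k∈ with range1-member k∈
  ... | m , m<j , refl = opR-labelled inv m<j

open Relabelling childrenₒ childrenT label HasLabel label-eq children-labelled

proposition4p3 : (p : List ℕ) →
    Data.Maybe.map label (nodeAt childrenₒ oneEdge p) ≡ nodeAt childrenT (1 , 1) p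
proposition4p3 = relabel oneEdge-labelled
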